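{- If $I$ is a YES-instance of WPPSG, then every transformation of $I$ (every instance obtainable from $I$ by a finite chain of valid elementary transformations) is a YES-instance too.
   Context: $\mathcal{S}_n$ is the symmetric group on $[n]=\{1,\ldots,n\}$, with $i\sigma$ the image of $i$ and products composed left to right; $X\sigma=\{i\sigma:i\in X\}$; $\mathcal{S}_X$ is the subgroup fixing every element outside $X$. An instance $(n,m,X_1,\ldots,X_m,\tau)$ of WPPSG ($X_j\subseteq[n]$, $\tau\in\mathcal{S}_n$) is a YES-instance iff $\tau=\sigma_1\cdots\sigma_m$ for some $\sigma_j\in\mathcal{S}_{X_j}$. For an instance $I=(n,m,X_1,\ldots,X_m,\tau)$ and $\pi\in\mathcal{S}_n$, $I^\pi=(n,m,X_1\pi,\ldots,X_m\pi,\pi^{ -1}\tau\pi)$. For $j'\in[m]$ and $\varphi\in\mathcal{S}_{X_{j'}}$, $I[j',\varphi]=(n,m,X'_1,\ldots,X'_m,\tau\varphi)$ with $X'_j=X_j$ for $j\le j'$ and $X'_j=X_j\varphi$ for $j>j'$; with $X_0=[n]$, $I[0,\varphi]=I^\varphi$. A valid elementary transformation of $I$ is any $I[j,\varphi]$ with $j\in\{0,\ldots,m\}$ and $\varphi\in\mathcal{S}_{X_j}$ (the sets $X_j$ being those of the current instance). -}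

module Defs where

open import Data.Nat using (ℕ; zero; suc)
open import Data.Fin using (Fin; zero; suc; _≤_; _>_)
open import Data.Fin.Subset using (Subset; _∈_; _∉_)
open import Data.Fin.Permutation using (Permutation′; _⟨$⟩ʳ_; _⟨$⟩ˡ_; _∘ₚ_; flip; id; _≈_)
open import Data.Vec using (tabulate; lookup)
open import Data.Product using (Σ; _×_)
open import Relation.Binary.PropositionalEquality using (_≡_)
open import Relation.Nullary using (Dec; yes; no)
open import Data.Fin using (_≤?_)

-- Permutations of [n] are represented by Fin n (points 0..n-1).
-- i σ  is  σ ⟨$⟩ʳ i ;  σ ∘ₚ ρ  composes left to right:  i(σρ) = (iσ)ρ.

InSym : {n : ℕ} → Subset n → Permutation′ n → Set
InSym X σ = ∀ i → i ∉ X → σ ⟨$⟩ʳ i ≡ i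

-- X σ = { i σ : i ∈ X } ; i ∈ Xσ  iff  i σ⁻¹ ∈ X
image : {n : ℕ} → Subset n → Permutation′ n → Subset n
image X σ = tabulate (λ i → lookup X (σ ⟨$⟩ˡ i))

prod : {n m : ℕ} → (Fin m → Permutation′ n) → Permutation′ n
prod {m = zero}  σ = id
prod {m = suc m} σ = σ zero ∘ₚ prod (λ j → σ (suc j))

-- an instance (n, m, X_1..X_m, τ); X j for j : Fin m is X_{j+1}
record Instance (n m : ℕ) : Set where
  constructor inst
  field
    X : Fin m → Subset n
    τ : Permutation′ n
open Instance public

YES : {n m : ℕ} → Instance n m → Set
YES {n} {m} I =
  Σ (Fin m → Permutation′ n) λ σ → (∀ j → InSym (X I j) (σ j)) × (I .τ ≈ prod σ)

conj : {n m : ℕ} → Instance n m → Permutation′ n → Instance n m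
conj I π = inst (λ j → image (X I j) π) (flip π ∘ₚ (I .τ ∘ₚ π))

-- I[j',φ] for j' = k+1 (k : Fin m): X_j unchanged for j ≤ j', X_j φ for j > j'
modify : {n m : ℕ} → Instance n m → Fin m → Permutation′ n → Instance n m
modify I k φ = inst X' (I .τ ∘ₚ φ)
  where
  X' : _
  X' j with j ≤? k
  ... | yes _ = X I j
  ... | no  _ = image (X I j) φ

-- valid elementary transformations (index 0 uses X_0 = [n], any φ)
data Elementary {n m : ℕ} : Instance n m → Instance n m → Set where
  step₀ : ∀ I (φ : Permutation′ n) → Elementary I (conj I φ)
  stepₖ : ∀ I (k : Fin m) (φ : Permutation′ n) → InSym (X I k) φ → Elementary I (modify I k φ)

data Transformation {n m : ℕ} : Instance n m → Instance n m → Set where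
  done : ∀ I → Transformation I I
  _then_ : ∀ {I J K} → Elementary I J → Transformation J K → Transformation I K

-- Each elementary transformation carries a factorisation along with it. Conjugating
-- by π turns τ = σ₁ ⋯ σₘ into π⁻¹τπ = (π⁻¹σ₁π) ⋯ (π⁻¹σₘπ) with π⁻¹σⱼπ ∈ S_{Xⱼπ}.
-- For I[k, φ] with φ ∈ S_{Xₖ}, inserting φφ⁻¹ gives
-- τφ = σ₁ ⋯ σₖ₋₁ (σₖφ) (φ⁻¹σₖ₊₁φ) ⋯ (φ⁻¹σₘφ), where σₖφ ∈ S_{Xₖ} and φ⁻¹σⱼφ ∈ S_{Xⱼφ}.
module Submission where

open import Defs
open import Data.Nat using (ℕ; z≤n; s≤s)
open import Data.Fin using (Fin; zero; suc; _≤_; _≤?_)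
open import Data.Fin.Subset using (Subset; _∉_)
open import Data.Fin.Permutation
  using (Permutation′; _⟨$⟩ʳ_; _⟨$⟩ˡ_; _∘ₚ_; flip; _≈_; inverseʳ; inverseˡ)
open import Data.Vec using (lookup)
open import Data.Vec.Functional using (tail)
open import Data.Vec.Properties using (lookup∘tabulate; lookup⇒[]=; []=⇒lookup)
open import Data.Product using (_,_)
open import Data.Empty using (⊥-elim)
open import Relation.Binary.PropositionalEquality using (sym; trans; cong; module ≡-Reasoning)
open import Relation.Nullary using (¬_; yes; no)

private
  variable
    n m : ℕ

conjugate : Permutation′ n → Permutation′ n → Permutation′ n
conjugate π σ = flip π ∘ₚ (σ ∘ₚ π)

∉-image : (X : Subset n) (π : Permutation′ n) {i : Fin n} →
          i ∉ image X π → π ⟨$⟩ˡ i ∉ X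
∉-image X π {i} i∉Xπ π⁻¹i∈X =
  i∉Xπ (lookup⇒[]= i (image X π)
          (trans (lookup∘tabulate (λ k → lookup X (π ⟨$⟩ˡ k)) i) ([]=⇒lookup π⁻¹i∈X)))

InSym-∘ₚ : (X : Subset n) (σ ρ : Permutation′ n) →
           InSym X σ → InSym X ρ → InSym X (σ ∘ₚ ρ)
InSym-∘ₚ X σ ρ σ∈S ρ∈S i i∉X = trans (cong (ρ ⟨$⟩ʳ_) (σ∈S i i∉X)) (ρ∈S i i∉X)

InSym-conjugate : (X : Subset n) (π σ : Permutation′ n) →
                  InSym X σ → InSym (image X π) (conjugate π σ)
InSym-conjugate X π σ σ∈S i i∉Xπ =
  trans (cong (π ⟨$⟩ʳ_) (σ∈S (π ⟨$⟩ˡ i) (∉-image X π i∉Xπ))) (inverseʳ π)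

prod-conjugate : (π : Permutation′ n) (σ : Fin m → Permutation′ n) →
                 prod (λ j → conjugate π (σ j)) ≈ conjugate π (prod σ)
prod-conjugate {m = ℕ.zero}  π σ i = sym (inverseʳ π)
prod-conjugate {m = ℕ.suc m} π σ i = begin
  prod (λ j → conjugate π (σ (suc j))) ⟨$⟩ʳ (π ⟨$⟩ʳ (σ zero ⟨$⟩ʳ (π ⟨$⟩ˡ i)))
    ≡⟨ prod-conjugate π (tail σ) _ ⟩
  π ⟨$⟩ʳ (prod (tail σ) ⟨$⟩ʳ (π ⟨$⟩ˡ (π ⟨$⟩ʳ (σ zero ⟨$⟩ʳ (π ⟨$⟩ˡ i)))))
    ≡⟨ cong (λ x → π ⟨$⟩ʳ (prod (tail σ) ⟨$⟩ʳ x)) (inverseˡ π) ⟩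
  π ⟨$⟩ʳ (prod (tail σ) ⟨$⟩ʳ (σ zero ⟨$⟩ʳ (π ⟨$⟩ˡ i)))
    ∎
  where open ≡-Reasoning

-- absorb φ k σ is the factorisation  σ₀ ⋯ σₖ₋₁ (σₖφ) (φ⁻¹σₖ₊₁φ) ⋯ (φ⁻¹σₘ₋₁φ)  of (prod σ) φ.
absorb : Permutation′ n → Fin m → (Fin m → Permutation′ n) → Fin m → Permutation′ n
absorb φ zero    σ zero    = σ zero ∘ₚ φ
absorb φ zero    σ (suc j) = conjugate φ (σ (suc j))
absorb φ (suc k) σ zero    = σ zero
absorb φ (suc k) σ (suc j) = absorb φ k (tail σ) j

prod-absorb : (φ : Permutation′ n) (k : Fin m) (σ : Fin m → Permutation′ n) →
              prod σ ∘ₚ φ ≈ prod (absorb φ k σ)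
prod-absorb φ zero σ i = begin
  φ ⟨$⟩ʳ (prod (tail σ) ⟨$⟩ʳ (σ zero ⟨$⟩ʳ i))
    ≡⟨ cong (λ x → φ ⟨$⟩ʳ (prod (tail σ) ⟨$⟩ʳ x)) (sym (inverseˡ φ)) ⟩
  conjugate φ (prod (tail σ)) ⟨$⟩ʳ (φ ⟨$⟩ʳ (σ zero ⟨$⟩ʳ i))
    ≡⟨ sym (prod-conjugate φ (tail σ) _) ⟩
  prod (λ j → conjugate φ (σ (suc j))) ⟨$⟩ʳ (φ ⟨$⟩ʳ (σ zero ⟨$⟩ʳ i))
    ∎
  where open ≡-Reasoning
prod-absorb φ (suc k) σ i = prod-absorb φ k (tail σ) (σ zero ⟨$⟩ʳ i)

InSym-absorb-≤ : (X : Fin m → Subset n) (φ : Permutation′ n) (k : Fin m)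
                 (σ : Fin m → Permutation′ n) →
                 (∀ j → InSym (X j) (σ j)) → InSym (X k) φ →
                 ∀ j → j ≤ k → InSym (X j) (absorb φ k σ j)
InSym-absorb-≤ X φ zero    σ σ∈S φ∈S zero    _       = InSym-∘ₚ (X zero) (σ zero) φ (σ∈S zero) φ∈S
InSym-absorb-≤ X φ (suc k) σ σ∈S φ∈S zero    _       = σ∈S zero
InSym-absorb-≤ X φ (suc k) σ σ∈S φ∈S (suc j) (s≤s j≤k) =
  InSym-absorb-≤ (tail X) φ k (tail σ) (λ j → σ∈S (suc j)) φ∈S j j≤k

InSym-absorb-> : (X : Fin m → Subset n) (φ : Permutation′ n) (k : Fin m)
                 (σ : Fin m → Permutation′ n) →
                 (∀ j → InSym (X j) (σ j)) →
                 ∀ j → ¬ (j ≤ k) → InSym (image (X j) φ) (absorb φ k σ j)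
InSym-absorb-> X φ k       σ σ∈S zero    j≰k = ⊥-elim (j≰k z≤n)
InSym-absorb-> X φ zero    σ σ∈S (suc j) _   = InSym-conjugate (X (suc j)) φ (σ (suc j)) (σ∈S (suc j))
InSym-absorb-> X φ (suc k) σ σ∈S (suc j) j≰k =
  InSym-absorb-> (tail X) φ k (tail σ) (λ j → σ∈S (suc j)) j (λ j≤k → j≰k (s≤s j≤k))

YES-conj : (I : Instance n m) (π : Permutation′ n) → YES I → YES (conj I π)
YES-conj I π (σ , σ∈S , τ≈) =
  (λ j → conjugate π (σ j)) ,
  (λ j → InSym-conjugate (X I j) π (σ j) (σ∈S j)) ,
  λ i → trans (cong (π ⟨$⟩ʳ_) (τ≈ (π ⟨$⟩ˡ i))) (sym (prod-conjugate π σ i))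

YES-modify : (I : Instance n m) (k : Fin m) (φ : Permutation′ n) →
             InSym (X I k) φ → YES I → YES (modify I k φ)
YES-modify I k φ φ∈S (σ , σ∈S , τ≈) =
  absorb φ k σ , absorb∈S , λ i → trans (cong (φ ⟨$⟩ʳ_) (τ≈ i)) (prod-absorb φ k σ i)
  where
  absorb∈S : ∀ j → InSym (X (modify I k φ) j) (absorb φ k σ j)
  absorb∈S j with j ≤? k
  ... | yes j≤k = InSym-absorb-≤ (X I) φ k σ σ∈S φ∈S j j≤k
  ... | no  j≰k = InSym-absorb-> (X I) φ k σ σ∈S j j≰k

YES-Elementary : {I J : Instance n m} → Elementary I J → YES I → YES J
YES-Elementary (step₀ I π)       = YES-conj I π
YES-Elementary (stepₖ I k φ φ∈S) = YES-modify I k φ φ∈S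

lemma5p2 : {n m : ℕ} (I J : Instance n m) → YES I → Transformation I J → YES J
lemma5p2 I .I yes-I (done .I)   = yes-I
lemma5p2 I J  yes-I (e then es) = lemma5p2 _ J (YES-Elementary e yes-I) es
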